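{- Let $T=\begin{pmatrix}1&1\\0&1\end{pmatrix}$, $S=\begin{pmatrix}0&1\\-1&0\end{pmatrix}$, $M=\begin{pmatrix}4&2\\-2&1\end{pmatrix}$, and let $\Gamma$ be the subgroup of $\mathrm{Sp}_4(\mathbb Z)$ generated by the block matrices $$\gamma_0=\begin{pmatrix}-STS&M\\0&T\end{pmatrix}=\begin{pmatrix}1&0&4&2\\-1&1&-2&1\\0&0&1&1\\0&0&0&1\end{pmatrix}\quad\text{and}\quad\gamma_1=\begin{pmatrix}0&S\\-S&0\end{pmatrix}=\begin{pmatrix}0&0&0&1\\0&0&-1&0\\0&-1&0&0\\1&0&0&0\end{pmatrix}.$$ Then $\Gamma$ has infinite index in $\mathrm{Sp}_4(\mathbb Z)$. -}

module Defs where

open import Data.Integer using (ℤ; +_; -[1+_]; _+_; _*_; -_)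
open import Data.Fin using (Fin)
open import Data.Vec using (Vec; []; _∷_; lookup; tabulate; foldr; zipWith; transpose)
open import Data.List using (List)
open import Data.List.Membership.Propositional using (_∈_)
open import Data.Product using (Σ; ∃; _×_; _,_)
open import Relation.Binary.PropositionalEquality using (_≡_)

-- 4×4 integer matrices, as a vector of rows.
Mat : Set
Mat = Vec (Vec ℤ 4) 4

dot : ∀ {n} → Vec ℤ n → Vec ℤ n → ℤ
dot u v = foldr _ _+_ (+ 0) (zipWith _*_ u v)

_·_ : Mat → Mat → Mat
A · B = tabulate λ i → tabulate λ j → dot (lookup A i) (lookup (transpose B) j)

infixl 7 _·_

I₄ : Mat
I₄ = (+ 1 ∷ + 0 ∷ + 0 ∷ + 0 ∷ []) ∷
     (+ 0 ∷ + 1 ∷ + 0 ∷ + 0 ∷ []) ∷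
     (+ 0 ∷ + 0 ∷ + 1 ∷ + 0 ∷ []) ∷
     (+ 0 ∷ + 0 ∷ + 0 ∷ + 1 ∷ []) ∷ []

J₄ : Mat
J₄ = (+ 0 ∷ + 0 ∷ + 1 ∷ + 0 ∷ []) ∷
     (+ 0 ∷ + 0 ∷ + 0 ∷ + 1 ∷ []) ∷
     (- + 1 ∷ + 0 ∷ + 0 ∷ + 0 ∷ []) ∷
     (+ 0 ∷ - + 1 ∷ + 0 ∷ + 0 ∷ []) ∷ []

InSp4 : Mat → Set
InSp4 g = transpose g · J₄ · g ≡ J₄

γ₀ : Mat
γ₀ = (+ 1 ∷ + 0 ∷ + 4 ∷ + 2 ∷ []) ∷
     (- + 1 ∷ + 1 ∷ - + 2 ∷ + 1 ∷ []) ∷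
     (+ 0 ∷ + 0 ∷ + 1 ∷ + 1 ∷ []) ∷
     (+ 0 ∷ + 0 ∷ + 0 ∷ + 1 ∷ []) ∷ []

γ₁ : Mat
γ₁ = (+ 0 ∷ + 0 ∷ + 0 ∷ + 1 ∷ []) ∷
     (+ 0 ∷ + 0 ∷ - + 1 ∷ + 0 ∷ []) ∷
     (+ 0 ∷ - + 1 ∷ + 0 ∷ + 0 ∷ []) ∷
     (+ 1 ∷ + 0 ∷ + 0 ∷ + 0 ∷ []) ∷ []

data InΓ : Mat → Set where
  gen₀ : InΓ γ₀
  gen₁ : InΓ γ₁
  one  : InΓ I₄
  mul  : ∀ {a b} → InΓ a → InΓ b → InΓ (a · b)
  inv  : ∀ {a b} → InΓ a → a · b ≡ I₄ → InΓ b

-- Γ has finite index in Sp₄(ℤ): finitely many left cosets hΓ (h ∈ Sp₄(ℤ))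
-- cover Sp₄(ℤ).
FiniteIndexInSp4 : Set
FiniteIndexInSp4 =
  Σ (List Mat) λ L →
    (∀ h → h ∈ L → InSp4 h) ×
    (∀ g → InSp4 g → Σ Mat λ h → h ∈ L × Σ Mat λ x → InΓ x × g ≡ h · x)

module Submission where

-- Γ acts on ℤ⁴ and we play ping-pong with the indefinite form φ(a,b,c,d) = a² + 4b² − 4c² − d².
-- γ₁ negates φ, while every nonzero power of γ₀ maps {φ < 0} ∪ {±q}, q = (1,0,0,−1), into
-- {φ > 0}: on {φ < 0} this comes from a sum-of-squares certificate for φ(γ₀ᵉ v) + φ(v) ≥ 0
-- (e ≠ 0), written in terms of a closed form of γ₀ᵉ.  Hence no nonempty reduced word in γ₀, γ₁
-- fixes q: q has trivial stabiliser in Γ.  In Sp₄(ℤ), however, q is fixed by the infinitely many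
-- transvections T(k); if finitely many cosets hΓ covered Sp₄(ℤ), two of them T(i) = h x,
-- T(j) = h y would give T(i)⁻¹ T(j) = x⁻¹ y ∈ Γ, a nontrivial element fixing q.

open import Defs
open import Relation.Nullary using (¬_; yes; no; contradiction)

open import Data.Fin using (Fin; toℕ; zero; suc)
import Data.Fin.Properties as Fin
open import Data.Integer
  using ( ℤ; +_; -[1+_]; +[1+_]; 0ℤ; 1ℤ; -1ℤ; _+_; _*_; -_; _-_; _≤_; _<_; _◃_; +≤+; +<+
        ; NonZero; nonNegative; positive; ≢-nonZero)
open import Data.Integer.Properties
  using ( _≟_; +-mono-≤; +-mono-≤-<; neg-mono-<; *-zeroʳ; *-monoˡ-≤-nonNeg; *-monoˡ-<-pos
        ; *-cancelˡ-≤-pos; *-cancelˡ-<-nonNeg; ◃-nonZero; i*j≢0; +-injective; <-irrefl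
        ; module ≤-Reasoning)
open import Data.Integer.Tactic.RingSolver using (ring)
open import Data.List using (List; []; _∷_; _++_; [_]; length)
import Data.List as List
open import Data.List.Membership.Propositional using (_∈_)
open import Data.List.Properties using (foldr-++)
open import Data.List.Relation.Unary.All using (All; []; _∷_)
open import Data.List.Relation.Unary.Any using (index)
open import Data.List.Relation.Unary.Any.Properties using (lookup-index)
open import Data.Nat using (ℕ; zero; suc; z≤n; s≤s)
import Data.Nat as ℕ
import Data.Nat.Properties as ℕₚ
open import Data.Product using (Σ; ∃; _×_; _,_; proj₁; proj₂)
import Data.Sign as Sign
open Sign using (Sign)
open import Data.Sum using (_⊎_; inj₁; inj₂)
open import Data.Vec using (Vec; []; _∷_; lookup; tabulate; transpose; map; zipWith; last)
import Data.Vec as Vec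
open import Data.Vec.Properties using (tabulate∘lookup; tabulate-cong)
open import Function using (_∘_; case_of_)
open import Relation.Binary.PropositionalEquality
  using (_≡_; refl; sym; trans; cong; subst; module ≡-Reasoning)
import Tactic.RingSolver.NonReflective as NonReflective

-- Every polynomial map below is written once over a ring signature and instantiated twice: at ℤ
-- for the mathematics, and at the expressions of the standard ring solver, where the identities
-- between these maps are proved by normalisation.
record RingOps (C : Set) : Set where
  infixl 6 _⊕_ _⊖_
  infixl 7 _⊗_
  infix  8 ⊝_
  field
    _⊕_ _⊗_ : C → C → C
    ⊝_      : C → C
    κ       : ℤ → C

  _⊖_ : C → C → C
  x ⊖ y = x ⊕ ⊝ y

  ⟨_⟩ : ℕ → C
  ⟨ n ⟩ = κ (+ n)

module Polynomial {C : Set} (ops : RingOps C) where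
  open RingOps ops

  C⁴ : Set
  C⁴ = Vec C 4

  Mat⁴ : Set
  Mat⁴ = Vec C⁴ 4

  lift : Mat → Mat⁴
  lift = map (map κ)

  dot′ : C⁴ → C⁴ → C
  dot′ u v = Vec.foldr _ _⊕_ (κ 0ℤ) (zipWith _⊗_ u v)

  infixl 7 _·′_
  infixr 5 _⊙_ _*ᵥ_

  _·′_ : Mat⁴ → Mat⁴ → Mat⁴
  A ·′ B = tabulate λ i → tabulate λ j → dot′ (lookup A i) (lookup (transpose B) j)

  _⊙_ : Mat⁴ → C⁴ → C⁴
  A ⊙ v = map (λ r → dot′ r v) A

  _*ᵥ_ : C → C⁴ → C⁴
  k *ᵥ v = map (k ⊗_) v

  φ : C⁴ → C
  φ (a ∷ b ∷ c ∷ d ∷ []) = a ⊗ a ⊕ ⟨ 4 ⟩ ⊗ (b ⊗ b) ⊖ ⟨ 4 ⟩ ⊗ (c ⊗ c) ⊖ d ⊗ d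

  -- 3·γ₀ᵉ: scaling by 3 clears the denominator of the term e(e−1)(e−2)/3, making the entries
  -- polynomial in e.
  U : C → C⁴ → C⁴
  U e (a ∷ b ∷ c ∷ d ∷ []) =
    ⟨ 3 ⟩ ⊗ a ⊕ ⟨ 3 ⟩ ⊗ e ⊗ (⟨ 4 ⟩ ⊗ c ⊕ ⟨ 2 ⟩ ⊗ d) ⊕ ⟨ 6 ⟩ ⊗ e ⊗ (e ⊖ ⟨ 1 ⟩) ⊗ d ∷
    ⟨ 3 ⟩ ⊗ b ⊖ ⟨ 3 ⟩ ⊗ e ⊗ (a ⊕ ⟨ 2 ⟩ ⊗ c ⊖ d) ⊖ ⟨ 6 ⟩ ⊗ e ⊗ (e ⊖ ⟨ 1 ⟩) ⊗ (c ⊕ d)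
      ⊖ ⟨ 2 ⟩ ⊗ e ⊗ (e ⊖ ⟨ 1 ⟩) ⊗ (e ⊖ ⟨ 2 ⟩) ⊗ d ∷
    ⟨ 3 ⟩ ⊗ c ⊕ ⟨ 3 ⟩ ⊗ e ⊗ d ∷
    ⟨ 3 ⟩ ⊗ d ∷ []

  Σ-squares : List (C × C) → C
  Σ-squares []             = κ 0ℤ
  Σ-squares ((w , x) ∷ ts) = w ⊗ (x ⊗ x) ⊕ Σ-squares ts

  multiplier : C → C
  multiplier m = (⟨ 2 ⟩ ⊗ m ⊕ ⟨ 1 ⟩) ⊗ (m ⊕ ⟨ 1 ⟩)

  -- (weight, base) pairs of a sum of squares; for m = e² ≥ 1 all weights are nonnegative.
  sos-terms : C → C → C⁴ → List (C × C)
  sos-terms m e (a ∷ b ∷ c ∷ d ∷ []) =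
    (m ⊕ ⟨ 1 ⟩ , ⟨ 3 ⟩ ⊗ (⟨ 2 ⟩ ⊗ m ⊕ ⟨ 1 ⟩) ⊗ a ⊖ ⟨ 6 ⟩ ⊗ e ⊗ b ⊕ ⟨ 6 ⟩ ⊗ e ⊗ (⟨ 2 ⟩ ⊗ m ⊕ ⟨ 1 ⟩) ⊗ c
                  ⊕ (⟨ 4 ⟩ ⊗ (m ⊗ m) ⊖ ⟨ 7 ⟩ ⊗ m) ⊗ d) ∷
    (⟨ 1 ⟩ , ⟨ 6 ⟩ ⊗ (m ⊕ ⟨ 1 ⟩) ⊗ b ⊕ e ⊗ (m ⊕ ⟨ 5 ⟩) ⊗ d) ∷
    ((m ⊖ ⟨ 1 ⟩) ⊗ ((⟨ 2 ⟩ ⊗ m ⊕ ⟨ 1 ⟩) ⊗ (⟨ 9 ⟩ ⊗ (m ⊕ ⟨ 1 ⟩))) , ⟨ 2 ⟩ ⊗ c ⊕ e ⊗ d) ∷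
    ((m ⊖ ⟨ 1 ⟩) ⊗ ((⟨ 2 ⟩ ⊗ m ⊕ ⟨ 1 ⟩) ⊗ (m ⊗ m ⊕ ⟨ 2 ⟩ ⊗ m ⊕ ⟨ 9 ⟩)) , d) ∷ []

  sos : C → C → C⁴ → C
  sos m e v = Σ-squares (sos-terms m e v)

  line : C → C⁴
  line x = x ∷ κ 0ℤ ∷ κ 0ℤ ∷ ⊝ x ∷ []

  -- The symplectic transvection v ↦ v − x·ω(q, v)·q along q = line 1, where ω(q, v) = v₁ + v₂.
  T : C → Mat⁴
  T x = (⟨ 1 ⟩ ∷ ⊝ x ∷ ⊝ x ∷ κ 0ℤ ∷ []) ∷
        (κ 0ℤ ∷ ⟨ 1 ⟩ ∷ κ 0ℤ ∷ κ 0ℤ ∷ []) ∷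
        (κ 0ℤ ∷ κ 0ℤ ∷ ⟨ 1 ⟩ ∷ κ 0ℤ ∷ []) ∷
        (κ 0ℤ ∷ x ∷ x ∷ ⟨ 1 ⟩ ∷ []) ∷ []

ℤ-ops : RingOps ℤ
ℤ-ops = record { _⊕_ = _+_ ; _⊗_ = _*_ ; ⊝_ = -_ ; κ = λ z → z }

open Polynomial ℤ-ops
  using (dot′; _⊙_; _*ᵥ_; φ; U; Σ-squares; multiplier; sos-terms; sos; line; T)

module Solver = NonReflective ring
open Solver using (Expr; Κ; _⊕_; _⊗_; ⊝_; solve; _⊜_)

expr-ops : ∀ n → RingOps (Expr ℤ n)
expr-ops n = record { _⊕_ = _⊕_ ; _⊗_ = _⊗_ ; ⊝_ = ⊝_ ; κ = Κ }

module ᴱ {n} = Polynomial (expr-ops n)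

-- Matrices acting on ℤ⁴

ℤ⁴ : Set
ℤ⁴ = Vec ℤ 4

vec₄-cong : ∀ {a b c d a′ b′ c′ d′ : ℤ} → a ≡ a′ → b ≡ b′ → c ≡ c′ → d ≡ d′ →
            _≡_ {A = ℤ⁴} (a ∷ b ∷ c ∷ d ∷ []) (a′ ∷ b′ ∷ c′ ∷ d′ ∷ [])
vec₄-cong refl refl refl refl = refl

lookup-ext : ∀ {A : Set} {n} {u v : Vec A n} → (∀ i → lookup u i ≡ lookup v i) → u ≡ v
lookup-ext {u = u} {v} u≗v = begin
  u                   ≡⟨ tabulate∘lookup u ⟨
  tabulate (lookup u) ≡⟨ tabulate-cong u≗v ⟩
  tabulate (lookup v) ≡⟨ tabulate∘lookup v ⟩
  v                   ∎
  where open ≡-Reasoning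

dot-·-⊙ : ∀ (r : ℤ⁴) B v → dot′ (tabulate λ j → dot r (lookup (transpose B) j)) v ≡ dot′ r (B ⊙ v)
dot-·-⊙ (x₀ ∷ x₁ ∷ x₂ ∷ x₃ ∷ [])
        ((y₀₀ ∷ y₀₁ ∷ y₀₂ ∷ y₀₃ ∷ []) ∷ (y₁₀ ∷ y₁₁ ∷ y₁₂ ∷ y₁₃ ∷ []) ∷
         (y₂₀ ∷ y₂₁ ∷ y₂₂ ∷ y₂₃ ∷ []) ∷ (y₃₀ ∷ y₃₁ ∷ y₃₂ ∷ y₃₃ ∷ []) ∷ [])
        (a ∷ b ∷ c ∷ d ∷ []) =
  solve 24 (λ x₀ x₁ x₂ x₃ y₀₀ y₀₁ y₀₂ y₀₃ y₁₀ y₁₁ y₁₂ y₁₃ y₂₀ y₂₁ y₂₂ y₂₃ y₃₀ y₃₁ y₃₂ y₃₃ a b c d →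
    let r = x₀ ∷ x₁ ∷ x₂ ∷ x₃ ∷ []
        B = (y₀₀ ∷ y₀₁ ∷ y₀₂ ∷ y₀₃ ∷ []) ∷ (y₁₀ ∷ y₁₁ ∷ y₁₂ ∷ y₁₃ ∷ []) ∷
            (y₂₀ ∷ y₂₁ ∷ y₂₂ ∷ y₂₃ ∷ []) ∷ (y₃₀ ∷ y₃₁ ∷ y₃₂ ∷ y₃₃ ∷ []) ∷ []
        v = a ∷ b ∷ c ∷ d ∷ []
    in ᴱ.dot′ (tabulate λ j → ᴱ.dot′ r (lookup (transpose B) j)) v ⊜ ᴱ.dot′ r (B ᴱ.⊙ v))
    refl x₀ x₁ x₂ x₃ y₀₀ y₀₁ y₀₂ y₀₃ y₁₀ y₁₁ y₁₂ y₁₃ y₂₀ y₂₁ y₂₂ y₂₃ y₃₀ y₃₁ y₃₂ y₃₃ a b c d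

·-⊙ : ∀ A B v → (A · B) ⊙ v ≡ A ⊙ B ⊙ v
·-⊙ (r₀ ∷ r₁ ∷ r₂ ∷ r₃ ∷ []) B v =
  vec₄-cong (dot-·-⊙ r₀ B v) (dot-·-⊙ r₁ B v) (dot-·-⊙ r₂ B v) (dot-·-⊙ r₃ B v)

I₄-⊙-eq : Fin 4 → (a b c d : Expr ℤ 4) → Expr ℤ 4 × Expr ℤ 4
I₄-⊙-eq i a b c d = lookup (ᴱ.lift I₄ ᴱ.⊙ v) i ⊜ lookup v i
  where v = a ∷ b ∷ c ∷ d ∷ []

I₄-⊙-entry : ∀ i a b c d → lookup (I₄ ⊙ (a ∷ b ∷ c ∷ d ∷ [])) i ≡ lookup (a ∷ b ∷ c ∷ d ∷ []) i
I₄-⊙-entry i@zero                   = solve 4 (I₄-⊙-eq i) refl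
I₄-⊙-entry i@(suc zero)             = solve 4 (I₄-⊙-eq i) refl
I₄-⊙-entry i@(suc (suc zero))       = solve 4 (I₄-⊙-eq i) refl
I₄-⊙-entry i@(suc (suc (suc zero))) = solve 4 (I₄-⊙-eq i) refl

I₄-⊙ : ∀ v → I₄ ⊙ v ≡ v
I₄-⊙ (a ∷ b ∷ c ∷ d ∷ []) = lookup-ext λ i → I₄-⊙-entry i a b c d

⊙-cancel : ∀ {A B} → A · B ≡ I₄ → ∀ v → A ⊙ B ⊙ v ≡ v
⊙-cancel {A} {B} AB≡I v = begin
  A ⊙ B ⊙ v   ≡⟨ ·-⊙ A B v ⟨
  (A · B) ⊙ v ≡⟨ cong (_⊙ v) AB≡I ⟩
  I₄ ⊙ v      ≡⟨ I₄-⊙ v ⟩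
  v           ∎
  where open ≡-Reasoning

dot′-*ᵥ : ∀ (r : ℤ⁴) k v → dot′ r (k *ᵥ v) ≡ k * dot′ r v
dot′-*ᵥ (x₀ ∷ x₁ ∷ x₂ ∷ x₃ ∷ []) k (a ∷ b ∷ c ∷ d ∷ []) =
  solve 9 (λ x₀ x₁ x₂ x₃ k a b c d →
             ᴱ.dot′ (x₀ ∷ x₁ ∷ x₂ ∷ x₃ ∷ []) (k ᴱ.*ᵥ (a ∷ b ∷ c ∷ d ∷ []))
           ⊜ k ⊗ ᴱ.dot′ (x₀ ∷ x₁ ∷ x₂ ∷ x₃ ∷ []) (a ∷ b ∷ c ∷ d ∷ []))
          refl x₀ x₁ x₂ x₃ k a b c d

⊙-*ᵥ : ∀ A k v → A ⊙ k *ᵥ v ≡ k *ᵥ A ⊙ v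
⊙-*ᵥ (r₀ ∷ r₁ ∷ r₂ ∷ r₃ ∷ []) k v =
  vec₄-cong (dot′-*ᵥ r₀ k v) (dot′-*ᵥ r₁ k v) (dot′-*ᵥ r₂ k v) (dot′-*ᵥ r₃ k v)

-- The quadratic form and the powers of γ₀

φ-*ᵥ : ∀ k v → φ (k *ᵥ v) ≡ k * k * φ v
φ-*ᵥ k (a ∷ b ∷ c ∷ d ∷ []) =
  solve 5 (λ k a b c d → ᴱ.φ (k ᴱ.*ᵥ (a ∷ b ∷ c ∷ d ∷ [])) ⊜ k ⊗ k ⊗ ᴱ.φ (a ∷ b ∷ c ∷ d ∷ [])) refl k a b c d

φ-γ₁ : ∀ v → φ (γ₁ ⊙ v) ≡ - φ v
φ-γ₁ (a ∷ b ∷ c ∷ d ∷ []) =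
  solve 4 (λ a b c d → ᴱ.φ (ᴱ.lift γ₁ ᴱ.⊙ (a ∷ b ∷ c ∷ d ∷ [])) ⊜ ⊝ ᴱ.φ (a ∷ b ∷ c ∷ d ∷ [])) refl a b c d

γ₀⁻¹ : Mat
γ₀⁻¹ = (+ 1 ∷ + 0 ∷ - + 4 ∷ + 2 ∷ []) ∷
       (+ 1 ∷ + 1 ∷ - + 2 ∷ - + 1 ∷ []) ∷
       (+ 0 ∷ + 0 ∷ + 1 ∷ - + 1 ∷ []) ∷
       (+ 0 ∷ + 0 ∷ + 0 ∷ + 1 ∷ []) ∷ []

data Letter : Set where
  α : Sign → Letter
  β : Letter

⟦_⟧ : Letter → Mat
⟦ α Sign.+ ⟧ = γ₀
⟦ α Sign.- ⟧ = γ₀⁻¹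
⟦ β ⟧        = γ₁

_⁻¹ : Letter → Letter
α s ⁻¹ = α (Sign.opposite s)
β ⁻¹   = β

⁻¹-inverseˡ : ∀ l → ⟦ l ⁻¹ ⟧ · ⟦ l ⟧ ≡ I₄
⁻¹-inverseˡ (α Sign.+) = refl
⁻¹-inverseˡ (α Sign.-) = refl
⁻¹-inverseˡ β          = refl

⁻¹-inverseʳ : ∀ l → ⟦ l ⟧ · ⟦ l ⁻¹ ⟧ ≡ I₄
⁻¹-inverseʳ (α Sign.+) = refl
⁻¹-inverseʳ (α Sign.-) = refl
⁻¹-inverseʳ β          = refl

infixr 5 γ₀^[_]⊙_

γ₀^[_]⊙_ : ℤ → ℤ⁴ → ℤ⁴
γ₀^[ + zero ]⊙       v = v
γ₀^[ +[1+ n ] ]⊙     v = γ₀ ⊙ γ₀^[ + n ]⊙ v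
γ₀^[ -[1+ zero ] ]⊙  v = γ₀⁻¹ ⊙ v
γ₀^[ -[1+ suc n ] ]⊙ v = γ₀⁻¹ ⊙ γ₀^[ -[1+ n ] ]⊙ v

γ₀^-step : ∀ s e v → ⟦ α s ⟧ ⊙ γ₀^[ e ]⊙ v ≡ γ₀^[ (s ◃ 1) + e ]⊙ v
γ₀^-step Sign.+ (+ n)          v = refl
γ₀^-step Sign.+ -[1+ zero ]    v = ⊙-cancel {γ₀} {γ₀⁻¹} refl v
γ₀^-step Sign.+ -[1+ suc n ]   v = ⊙-cancel {γ₀} {γ₀⁻¹} refl _
γ₀^-step Sign.- (+ zero)       v = refl
γ₀^-step Sign.- +[1+ n ]       v = ⊙-cancel {γ₀⁻¹} {γ₀} refl _
γ₀^-step Sign.- -[1+ n ]       v = refl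

U-zero-eq : Fin 4 → (a b c d : Expr ℤ 4) → Expr ℤ 4 × Expr ℤ 4
U-zero-eq i a b c d = lookup (ᴱ.U (Κ 0ℤ) v) i ⊜ lookup (Κ (+ 3) ᴱ.*ᵥ v) i
  where v = a ∷ b ∷ c ∷ d ∷ []

U-zero-entry : ∀ i a b c d → lookup (U 0ℤ (a ∷ b ∷ c ∷ d ∷ [])) i ≡ lookup (+ 3 *ᵥ (a ∷ b ∷ c ∷ d ∷ [])) i
U-zero-entry i@zero                   = solve 4 (U-zero-eq i) refl
U-zero-entry i@(suc zero)             = solve 4 (U-zero-eq i) refl
U-zero-entry i@(suc (suc zero))       = solve 4 (U-zero-eq i) refl
U-zero-entry i@(suc (suc (suc zero))) = solve 4 (U-zero-eq i) refl

U-zero : ∀ v → U 0ℤ v ≡ + 3 *ᵥ v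
U-zero (a ∷ b ∷ c ∷ d ∷ []) = lookup-ext λ i → U-zero-entry i a b c d

U-step-eq : Sign → Fin 4 → (e a b c d : Expr ℤ 5) → Expr ℤ 5 × Expr ℤ 5
U-step-eq s i e a b c d = lookup (ᴱ.lift ⟦ α s ⟧ ᴱ.⊙ ᴱ.U e v) i ⊜ lookup (ᴱ.U (Κ (s ◃ 1) ⊕ e) v) i
  where v = a ∷ b ∷ c ∷ d ∷ []

U-step-entry : ∀ s i e a b c d →
               lookup (⟦ α s ⟧ ⊙ U e (a ∷ b ∷ c ∷ d ∷ [])) i ≡ lookup (U ((s ◃ 1) + e) (a ∷ b ∷ c ∷ d ∷ [])) i
U-step-entry s@Sign.+ i@zero                   = solve 5 (U-step-eq s i) refl
U-step-entry s@Sign.+ i@(suc zero)             = solve 5 (U-step-eq s i) refl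
U-step-entry s@Sign.+ i@(suc (suc zero))       = solve 5 (U-step-eq s i) refl
U-step-entry s@Sign.+ i@(suc (suc (suc zero))) = solve 5 (U-step-eq s i) refl
U-step-entry s@Sign.- i@zero                   = solve 5 (U-step-eq s i) refl
U-step-entry s@Sign.- i@(suc zero)             = solve 5 (U-step-eq s i) refl
U-step-entry s@Sign.- i@(suc (suc zero))       = solve 5 (U-step-eq s i) refl
U-step-entry s@Sign.- i@(suc (suc (suc zero))) = solve 5 (U-step-eq s i) refl

U-step : ∀ s e v → ⟦ α s ⟧ ⊙ U e v ≡ U ((s ◃ 1) + e) v
U-step s e (a ∷ b ∷ c ∷ d ∷ []) = lookup-ext λ i → U-step-entry s i e a b c d

U-closed-form-step : ∀ s e v → + 3 *ᵥ γ₀^[ e ]⊙ v ≡ U e v →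
                     + 3 *ᵥ ⟦ α s ⟧ ⊙ γ₀^[ e ]⊙ v ≡ U ((s ◃ 1) + e) v
U-closed-form-step s e v 3γ₀^e≡U = begin
  + 3 *ᵥ ⟦ α s ⟧ ⊙ γ₀^[ e ]⊙ v ≡⟨ ⊙-*ᵥ ⟦ α s ⟧ (+ 3) (γ₀^[ e ]⊙ v) ⟨
  ⟦ α s ⟧ ⊙ + 3 *ᵥ γ₀^[ e ]⊙ v ≡⟨ cong (⟦ α s ⟧ ⊙_) 3γ₀^e≡U ⟩
  ⟦ α s ⟧ ⊙ U e v              ≡⟨ U-step s e v ⟩
  U ((s ◃ 1) + e) v            ∎
  where open ≡-Reasoning

U-closed-form : ∀ e v → + 3 *ᵥ γ₀^[ e ]⊙ v ≡ U e v
U-closed-form (+ zero)     v = sym (U-zero v)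
U-closed-form +[1+ n ]     v = U-closed-form-step Sign.+ (+ n) v (U-closed-form (+ n) v)
U-closed-form -[1+ zero ]  v = U-closed-form-step Sign.- 0ℤ v (sym (U-zero v))
U-closed-form -[1+ suc n ] v = U-closed-form-step Sign.- -[1+ n ] v (U-closed-form -[1+ n ] v)

φ-U : ∀ e v → φ (U e v) ≡ + 9 * φ (γ₀^[ e ]⊙ v)
φ-U e v = trans (cong φ (sym (U-closed-form e v))) (φ-*ᵥ (+ 3) (γ₀^[ e ]⊙ v))

-- The ping-pong inequalities

square-nonNeg : ∀ i → 0ℤ ≤ i * i
square-nonNeg (+ zero) = +≤+ z≤n
square-nonNeg +[1+ n ] = +≤+ z≤n
square-nonNeg -[1+ n ] = +≤+ z≤n

square-pos : ∀ i .{{_ : NonZero i}} → 0ℤ < i * i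
square-pos +[1+ n ] = +<+ (s≤s z≤n)
square-pos -[1+ n ] = +<+ (s≤s z≤n)

square-suc : ∀ i .{{_ : NonZero i}} → ∃ λ t → i * i ≡ + suc t
square-suc +[1+ n ] = _ , refl
square-suc -[1+ n ] = _ , refl

+-nonNeg : ∀ i j → 0ℤ ≤ i → 0ℤ ≤ j → 0ℤ ≤ i + j
+-nonNeg _ _ = +-mono-≤

*-nonNeg : ∀ i j → 0ℤ ≤ i → 0ℤ ≤ j → 0ℤ ≤ i * j
*-nonNeg i j 0≤i 0≤j =
  subst (_≤ i * j) (*-zeroʳ i) (*-monoˡ-≤-nonNeg i {{nonNegative 0≤i}} 0≤j)

*-pos : ∀ i j → 0ℤ < i → 0ℤ < j → 0ℤ < i * j
*-pos i j 0<i 0<j = subst (_< i * j) (*-zeroʳ i) (*-monoˡ-<-pos i {{positive 0<i}} 0<j)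

+◃-nonNeg : ∀ n → 0ℤ ≤ Sign.+ ◃ n
+◃-nonNeg zero    = +≤+ z≤n
+◃-nonNeg (suc n) = +≤+ z≤n

+-neg-cancelʳ : ∀ x y → x + y + - y ≡ x
+-neg-cancelʳ = solve 2 (λ x y → x ⊕ y ⊕ ⊝ y ⊜ x) refl

0≤x+y∧y<0⇒0<x : ∀ x y → 0ℤ ≤ x + y → y < 0ℤ → 0ℤ < x
0≤x+y∧y<0⇒0<x x y 0≤x+y y<0 =
  subst (0ℤ <_) (+-neg-cancelʳ x y) (+-mono-≤-< 0≤x+y (neg-mono-< y<0))

Σ-squares-nonNeg : ∀ ts → All (λ t → 0ℤ ≤ proj₁ t) ts → 0ℤ ≤ Σ-squares ts
Σ-squares-nonNeg []             []         = +≤+ z≤n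
Σ-squares-nonNeg ((w , x) ∷ ts) (0≤w ∷ ps) =
  +-nonNeg (w * (x * x)) (Σ-squares ts) (*-nonNeg w (x * x) 0≤w (square-nonNeg x))
           (Σ-squares-nonNeg ts ps)

sos-certificate : ∀ e v → multiplier (e * e) * (φ (U e v) + + 9 * φ v) ≡ + 2 * sos (e * e) e v
sos-certificate e (a ∷ b ∷ c ∷ d ∷ []) =
  solve 5 (λ e a b c d → let v = a ∷ b ∷ c ∷ d ∷ [] in
             ᴱ.multiplier (e ⊗ e) ⊗ (ᴱ.φ (ᴱ.U e v) ⊕ Κ (+ 9) ⊗ ᴱ.φ v) ⊜ Κ (+ 2) ⊗ ᴱ.sos (e ⊗ e) e v)
          refl e a b c d

-- For m = + suc t the weights of sos-terms compute to literals + k, or to Sign.+ ◃ n when they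
-- are products.
sos-nonNeg : ∀ t e v → 0ℤ ≤ sos (+ suc t) e v
sos-nonNeg t e v@(_ ∷ _ ∷ _ ∷ _ ∷ []) =
  Σ-squares-nonNeg (sos-terms (+ suc t) e v) (+≤+ z≤n ∷ +≤+ z≤n ∷ +◃-nonNeg _ ∷ +◃-nonNeg _ ∷ [])

φ-U-lower-bound : ∀ e .{{_ : NonZero e}} v → 0ℤ ≤ φ (U e v) + + 9 * φ v
φ-U-lower-bound e v with square-suc e
... | t , e²≡1+t = *-cancelˡ-≤-pos 0ℤ _ (multiplier (+ suc t)) (begin
  multiplier (+ suc t) * 0ℤ                      ≡⟨ *-zeroʳ (multiplier (+ suc t)) ⟩
  0ℤ                                             ≤⟨ 0≤2·sos ⟩
  + 2 * sos (+ suc t) e v                        ≡⟨ certificate ⟨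
  multiplier (+ suc t) * (φ (U e v) + + 9 * φ v) ∎)
  where
  open ≤-Reasoning
  0≤2·sos : 0ℤ ≤ + 2 * sos (+ suc t) e v
  0≤2·sos = *-nonNeg (+ 2) (sos (+ suc t) e v) (+≤+ z≤n) (sos-nonNeg t e v)
  certificate : multiplier (+ suc t) * (φ (U e v) + + 9 * φ v) ≡ + 2 * sos (+ suc t) e v
  certificate = subst (λ m → multiplier m * (φ (U e v) + + 9 * φ v) ≡ + 2 * sos m e v)
                      e²≡1+t (sos-certificate e v)

γ₀^-negative⇒positive : ∀ e .{{_ : NonZero e}} v → φ v < 0ℤ → 0ℤ < φ (γ₀^[ e ]⊙ v)
γ₀^-negative⇒positive e v φv<0 =
  *-cancelˡ-<-nonNeg {i = 0ℤ} (+ 9) (0≤x+y∧y<0⇒0<x _ _ lower-bound (*-monoˡ-<-pos (+ 9) φv<0))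
  where
  lower-bound : 0ℤ ≤ + 9 * φ (γ₀^[ e ]⊙ v) + + 9 * φ v
  lower-bound = subst (λ x → 0ℤ ≤ x + + 9 * φ v) (φ-U e v) (φ-U-lower-bound e v)

q : ℤ⁴
q = line 1ℤ

φ-U-line : ∀ e x → + 4 * φ (U e (line x)) ≡
                   (x * e) * (x * e) * ((+ 8 * (e * e) - + 23) * (+ 8 * (e * e) - + 23) + + 207)
φ-U-line = solve 2 (λ e x → let y = Κ (+ 8) ⊗ (e ⊗ e) ⊕ ⊝ Κ (+ 23) in
                     Κ (+ 4) ⊗ ᴱ.φ (ᴱ.U e (ᴱ.line x)) ⊜ (x ⊗ e) ⊗ (x ⊗ e) ⊗ (y ⊗ y ⊕ Κ (+ 207)))
                   refl

γ₀^-line⇒positive : ∀ e .{{_ : NonZero e}} x .{{_ : NonZero x}} → 0ℤ < φ (γ₀^[ e ]⊙ line x)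
γ₀^-line⇒positive e x = *-cancelˡ-<-nonNeg {i = 0ℤ} (+ 9) (*-cancelˡ-<-nonNeg {i = 0ℤ} (+ 4) (begin-strict
  0ℤ                                    <⟨ *-pos (x * e * (x * e)) (Y * Y + + 207)
                                                 (square-pos (x * e) {{i*j≢0 x e}})
                                                 (+-mono-≤-< (square-nonNeg Y) (+<+ (s≤s z≤n))) ⟩
  x * e * (x * e) * (Y * Y + + 207)    ≡⟨ φ-U-line e x ⟨
  + 4 * φ (U e (line x))                ≡⟨ cong (+ 4 *_) (φ-U e (line x)) ⟩
  + 4 * (+ 9 * φ (γ₀^[ e ]⊙ line x))    ∎))
  where
  open ≤-Reasoning
  Y : ℤ
  Y = + 8 * (e * e) - + 23

-- Reduced words and ping-pong

-- Reduced words of the free product ⟨γ₀⟩ ∗ ⟨γ₁ ∣ γ₁²⟩, according to their leftmost syllable.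
mutual
  data A-Word : Set where
    α^_   : (e : ℤ) .{{_ : NonZero e}} → A-Word
    α^_▸_ : (e : ℤ) .{{_ : NonZero e}} → B-Word → A-Word

  data B-Word : Set where
    β   : B-Word
    β▸_ : A-Word → B-Word

data Reduced : Set where
  ε : Reduced
  A : A-Word → Reduced
  B : B-Word → Reduced

mutual
  ⟦_⟧ᴬ : A-Word → ℤ⁴ → ℤ⁴
  ⟦ α^ e ⟧ᴬ     v = γ₀^[ e ]⊙ v
  ⟦ α^ e ▸ w ⟧ᴬ v = γ₀^[ e ]⊙ ⟦ w ⟧ᴮ v

  ⟦_⟧ᴮ : B-Word → ℤ⁴ → ℤ⁴
  ⟦ β ⟧ᴮ    v = γ₁ ⊙ v
  ⟦ β▸ w ⟧ᴮ v = γ₁ ⊙ ⟦ w ⟧ᴬ v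

⟦_⟧ʳ : Reduced → ℤ⁴ → ℤ⁴
⟦ ε ⟧ʳ   v = v
⟦ A w ⟧ʳ v = ⟦ w ⟧ᴬ v
⟦ B w ⟧ʳ v = ⟦ w ⟧ᴮ v

mutual
  A-Word-positive : ∀ w → 0ℤ < φ (⟦ w ⟧ᴬ q)
  A-Word-positive (α^ e) = γ₀^-line⇒positive e 1ℤ
  A-Word-positive (α^ e ▸ w) with B-Word-negative w
  ... | inj₁ w·q≡-q = subst (λ u → 0ℤ < φ (γ₀^[ e ]⊙ u)) (sym w·q≡-q) (γ₀^-line⇒positive e -1ℤ)
  ... | inj₂ φ<0    = γ₀^-negative⇒positive e (⟦ w ⟧ᴮ q) φ<0

  B-Word-negative : ∀ w → ⟦ w ⟧ᴮ q ≡ line -1ℤ ⊎ φ (⟦ w ⟧ᴮ q) < 0ℤ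
  B-Word-negative β      = inj₁ refl
  B-Word-negative (β▸ w) = inj₂ (subst (_< 0ℤ) (sym (φ-γ₁ (⟦ w ⟧ᴬ q))) (neg-mono-< (A-Word-positive w)))

only-ε-fixes-q : ∀ r → ⟦ r ⟧ʳ q ≡ q → r ≡ ε
only-ε-fixes-q ε     _     = refl
only-ε-fixes-q (A w) w·q≡q =
  contradiction (subst (λ u → 0ℤ < φ u) w·q≡q (A-Word-positive w)) (<-irrefl refl)
only-ε-fixes-q (B w) w·q≡q with B-Word-negative w
... | inj₁ w·q≡-q = case trans (sym w·q≡q) w·q≡-q of λ ()
... | inj₂ φ<0    = contradiction (subst (λ u → φ u < 0ℤ) w·q≡q φ<0) (<-irrefl refl)

-- Words in the generators

infixr 5 _∙_

_∙_ : Letter → Reduced → Reduced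
α s ∙ ε           = A (α^_ (s ◃ 1) {{◃-nonZero s 1}})
α s ∙ A (α^ e) with (s ◃ 1) + e ≟ 0ℤ
... | yes _   = ε
... | no e′≢0 = A (α^_ ((s ◃ 1) + e) {{≢-nonZero e′≢0}})
α s ∙ A (α^ e ▸ w) with (s ◃ 1) + e ≟ 0ℤ
... | yes _   = B w
... | no e′≢0 = A (α^_▸_ ((s ◃ 1) + e) {{≢-nonZero e′≢0}} w)
α s ∙ B w         = A (α^_▸_ (s ◃ 1) {{◃-nonZero s 1}} w)
β ∙ ε             = B β
β ∙ A w           = B (β▸ w)
β ∙ B β           = ε
β ∙ B (β▸ w)      = A w

∙-correct : ∀ l r v → ⟦ l ∙ r ⟧ʳ v ≡ ⟦ l ⟧ ⊙ ⟦ r ⟧ʳ v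
∙-correct (α Sign.+) ε              v = refl
∙-correct (α Sign.-) ε              v = refl
∙-correct (α s)      (A (α^ e))     v with (s ◃ 1) + e ≟ 0ℤ
... | yes e′≡0 = sym (trans (γ₀^-step s e v) (cong (γ₀^[_]⊙ v) e′≡0))
... | no _     = sym (γ₀^-step s e v)
∙-correct (α s)      (A (α^ e ▸ w)) v with (s ◃ 1) + e ≟ 0ℤ
... | yes e′≡0 = sym (trans (γ₀^-step s e (⟦ w ⟧ᴮ v)) (cong (γ₀^[_]⊙ ⟦ w ⟧ᴮ v) e′≡0))
... | no _     = sym (γ₀^-step s e (⟦ w ⟧ᴮ v))
∙-correct (α Sign.+) (B w)          v = refl
∙-correct (α Sign.-) (B w)          v = refl
∙-correct β          ε              v = refl
∙-correct β          (A w)          v = refl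
∙-correct β          (B β)          v = sym (⊙-cancel {γ₁} {γ₁} refl v)
∙-correct β          (B (β▸ w))     v = sym (⊙-cancel {γ₁} {γ₁} refl (⟦ w ⟧ᴬ v))

Word : Set
Word = List Letter

infixr 5 _⊛_

_⊛_ : Word → ℤ⁴ → ℤ⁴
w ⊛ v = List.foldr (λ l u → ⟦ l ⟧ ⊙ u) v w

⊛-++ : ∀ u w v → (u ++ w) ⊛ v ≡ u ⊛ w ⊛ v
⊛-++ u w v = foldr-++ (λ l u → ⟦ l ⟧ ⊙ u) v u w

inverse : Word → Word
inverse []      = []
inverse (l ∷ w) = inverse w ++ [ l ⁻¹ ]

inverse-⊛ˡ : ∀ w v → inverse w ⊛ w ⊛ v ≡ v
inverse-⊛ˡ []      v = refl
inverse-⊛ˡ (l ∷ w) v = begin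
  (inverse w ++ [ l ⁻¹ ]) ⊛ ⟦ l ⟧ ⊙ w ⊛ v ≡⟨ ⊛-++ (inverse w) [ l ⁻¹ ] _ ⟩
  inverse w ⊛ ⟦ l ⁻¹ ⟧ ⊙ ⟦ l ⟧ ⊙ w ⊛ v     ≡⟨ cong (inverse w ⊛_) (⊙-cancel {⟦ l ⁻¹ ⟧} {⟦ l ⟧} (⁻¹-inverseˡ l) _) ⟩
  inverse w ⊛ w ⊛ v                       ≡⟨ inverse-⊛ˡ w v ⟩
  v                                       ∎
  where open ≡-Reasoning

inverse-⊛ʳ : ∀ w v → w ⊛ inverse w ⊛ v ≡ v
inverse-⊛ʳ []      v = refl
inverse-⊛ʳ (l ∷ w) v = begin
  ⟦ l ⟧ ⊙ w ⊛ (inverse w ++ [ l ⁻¹ ]) ⊛ v ≡⟨ cong (λ u → ⟦ l ⟧ ⊙ w ⊛ u) (⊛-++ (inverse w) [ l ⁻¹ ] v) ⟩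
  ⟦ l ⟧ ⊙ w ⊛ inverse w ⊛ ⟦ l ⁻¹ ⟧ ⊙ v     ≡⟨ cong (⟦ l ⟧ ⊙_) (inverse-⊛ʳ w _) ⟩
  ⟦ l ⟧ ⊙ ⟦ l ⁻¹ ⟧ ⊙ v                     ≡⟨ ⊙-cancel {⟦ l ⟧} {⟦ l ⁻¹ ⟧} (⁻¹-inverseʳ l) v ⟩
  v                                       ∎
  where open ≡-Reasoning

reduce : Word → Reduced
reduce = List.foldr _∙_ ε

reduce-correct : ∀ w v → ⟦ reduce w ⟧ʳ v ≡ w ⊛ v
reduce-correct []      v = refl
reduce-correct (l ∷ w) v = trans (∙-correct l (reduce w) v) (cong (⟦ l ⟧ ⊙_) (reduce-correct w v))

q-stabiliser-trivial : ∀ w → w ⊛ q ≡ q → ∀ v → w ⊛ v ≡ v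
q-stabiliser-trivial w w·q≡q v = begin
  w ⊛ v              ≡⟨ reduce-correct w v ⟨
  ⟦ reduce w ⟧ʳ v    ≡⟨ cong (λ r → ⟦ r ⟧ʳ v) (only-ε-fixes-q (reduce w) reduce-w·q≡q) ⟩
  v                  ∎
  where
  open ≡-Reasoning
  reduce-w·q≡q : ⟦ reduce w ⟧ʳ q ≡ q
  reduce-w·q≡q = trans (reduce-correct w q) w·q≡q

InΓ⇒word : ∀ {x} → InΓ x → Σ Word λ w → ∀ v → x ⊙ v ≡ w ⊛ v
InΓ⇒word gen₀ = [ α Sign.+ ] , λ _ → refl
InΓ⇒word gen₁ = [ β ] , λ _ → refl
InΓ⇒word one  = [] , I₄-⊙
InΓ⇒word (mul {a} {b} a∈Γ b∈Γ) with InΓ⇒word a∈Γ | InΓ⇒word b∈Γ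
... | u , a≈u | w , b≈w = u ++ w , λ v → begin
  (a · b) ⊙ v  ≡⟨ ·-⊙ a b v ⟩
  a ⊙ b ⊙ v    ≡⟨ a≈u (b ⊙ v) ⟩
  u ⊛ b ⊙ v    ≡⟨ cong (u ⊛_) (b≈w v) ⟩
  u ⊛ w ⊛ v    ≡⟨ ⊛-++ u w v ⟨
  (u ++ w) ⊛ v ∎
  where open ≡-Reasoning
InΓ⇒word (inv {a} {b} a∈Γ ab≡I) with InΓ⇒word a∈Γ
... | u , a≈u = inverse u , λ v → begin
  b ⊙ v                   ≡⟨ inverse-⊛ˡ u (b ⊙ v) ⟨
  inverse u ⊛ u ⊛ b ⊙ v   ≡⟨ cong (inverse u ⊛_) (a≈u (b ⊙ v)) ⟨
  inverse u ⊛ a ⊙ b ⊙ v   ≡⟨ cong (inverse u ⊛_) (⊙-cancel {a} {b} ab≡I v) ⟩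
  inverse u ⊛ v           ∎
  where open ≡-Reasoning

-- Transvections and the index of Γ

T-symplectic-eq : Fin 4 → Fin 4 → (x : Expr ℤ 1) → Expr ℤ 1 × Expr ℤ 1
T-symplectic-eq i j x =
  lookup (lookup (transpose (ᴱ.T x) ᴱ.·′ ᴱ.lift J₄ ᴱ.·′ ᴱ.T x) i) j ⊜ lookup (lookup (ᴱ.lift J₄) i) j

T-symplectic-entry : ∀ i j x → lookup (lookup (transpose (T x) · J₄ · T x) i) j ≡ lookup (lookup J₄ i) j
T-symplectic-entry i@zero j@zero                                     = solve 1 (T-symplectic-eq i j) refl
T-symplectic-entry i@zero j@(suc zero)                               = solve 1 (T-symplectic-eq i j) refl
T-symplectic-entry i@zero j@(suc (suc zero))                         = solve 1 (T-symplectic-eq i j) refl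
T-symplectic-entry i@zero j@(suc (suc (suc zero)))                   = solve 1 (T-symplectic-eq i j) refl
T-symplectic-entry i@(suc zero) j@zero                               = solve 1 (T-symplectic-eq i j) refl
T-symplectic-entry i@(suc zero) j@(suc zero)                         = solve 1 (T-symplectic-eq i j) refl
T-symplectic-entry i@(suc zero) j@(suc (suc zero))                   = solve 1 (T-symplectic-eq i j) refl
T-symplectic-entry i@(suc zero) j@(suc (suc (suc zero)))             = solve 1 (T-symplectic-eq i j) refl
T-symplectic-entry i@(suc (suc zero)) j@zero                         = solve 1 (T-symplectic-eq i j) refl
T-symplectic-entry i@(suc (suc zero)) j@(suc zero)                   = solve 1 (T-symplectic-eq i j) refl
T-symplectic-entry i@(suc (suc zero)) j@(suc (suc zero))             = solve 1 (T-symplectic-eq i j) refl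
T-symplectic-entry i@(suc (suc zero)) j@(suc (suc (suc zero)))       = solve 1 (T-symplectic-eq i j) refl
T-symplectic-entry i@(suc (suc (suc zero))) j@zero                   = solve 1 (T-symplectic-eq i j) refl
T-symplectic-entry i@(suc (suc (suc zero))) j@(suc zero)             = solve 1 (T-symplectic-eq i j) refl
T-symplectic-entry i@(suc (suc (suc zero))) j@(suc (suc zero))       = solve 1 (T-symplectic-eq i j) refl
T-symplectic-entry i@(suc (suc (suc zero))) j@(suc (suc (suc zero))) = solve 1 (T-symplectic-eq i j) refl

T-symplectic : ∀ x → InSp4 (T x)
T-symplectic x = lookup-ext λ i → lookup-ext λ j → T-symplectic-entry i j x

T-inverse-eq : Fin 4 → (x a b c d : Expr ℤ 5) → Expr ℤ 5 × Expr ℤ 5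
T-inverse-eq i x a b c d = lookup (ᴱ.T (⊝ x) ᴱ.⊙ ᴱ.T x ᴱ.⊙ v) i ⊜ lookup v i
  where v = a ∷ b ∷ c ∷ d ∷ []

T-inverse-⊙-entry : ∀ i x a b c d →
                    lookup (T (- x) ⊙ T x ⊙ (a ∷ b ∷ c ∷ d ∷ [])) i ≡ lookup (a ∷ b ∷ c ∷ d ∷ []) i
T-inverse-⊙-entry i@zero                   = solve 5 (T-inverse-eq i) refl
T-inverse-⊙-entry i@(suc zero)             = solve 5 (T-inverse-eq i) refl
T-inverse-⊙-entry i@(suc (suc zero))       = solve 5 (T-inverse-eq i) refl
T-inverse-⊙-entry i@(suc (suc (suc zero))) = solve 5 (T-inverse-eq i) refl

T-inverse-⊙ : ∀ x v → T (- x) ⊙ T x ⊙ v ≡ v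
T-inverse-⊙ x (a ∷ b ∷ c ∷ d ∷ []) = lookup-ext λ i → T-inverse-⊙-entry i x a b c d

T-fixes-q-eq : Fin 4 → (x : Expr ℤ 1) → Expr ℤ 1 × Expr ℤ 1
T-fixes-q-eq i x = lookup (ᴱ.T x ᴱ.⊙ ᴱ.line (Κ 1ℤ)) i ⊜ lookup (ᴱ.line (Κ 1ℤ)) i

T-fixes-q-entry : ∀ i x → lookup (T x ⊙ q) i ≡ lookup q i
T-fixes-q-entry i@zero                   = solve 1 (T-fixes-q-eq i) refl
T-fixes-q-entry i@(suc zero)             = solve 1 (T-fixes-q-eq i) refl
T-fixes-q-entry i@(suc (suc zero))       = solve 1 (T-fixes-q-eq i) refl
T-fixes-q-entry i@(suc (suc (suc zero))) = solve 1 (T-fixes-q-eq i) refl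

T-fixes-q : ∀ x → T x ⊙ q ≡ q
T-fixes-q x = lookup-ext λ i → T-fixes-q-entry i x

e₁ : ℤ⁴
e₁ = 0ℤ ∷ 1ℤ ∷ 0ℤ ∷ 0ℤ ∷ []

T-shear : ∀ x → last (T x ⊙ e₁) ≡ x
T-shear = solve 1 (λ x → last (ᴱ.T x ᴱ.⊙ (Κ 0ℤ ∷ Κ 1ℤ ∷ Κ 0ℤ ∷ Κ 0ℤ ∷ [])) ⊜ x) refl

T-cosets-distinct : ∀ {h x y} i j → InΓ x → InΓ y → T i ≡ h · x → T j ≡ h · y → i ≡ j
T-cosets-distinct {h} {x} {y} i j x∈Γ y∈Γ Tᵢ≡hx Tⱼ≡hy with InΓ⇒word x∈Γ | InΓ⇒word y∈Γ
... | u , x≈u | w , y≈w = begin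
  i               ≡⟨ T-shear i ⟨
  last (T i ⊙ e₁) ≡⟨ cong last (Tᵢ≈Tⱼ e₁) ⟩
  last (T j ⊙ e₁) ≡⟨ T-shear j ⟩
  j               ∎
  where
  open ≡-Reasoning
  W : Word
  W = inverse u ++ w
  Tᵢ∘W≈Tⱼ : ∀ v → T i ⊙ W ⊛ v ≡ T j ⊙ v
  Tᵢ∘W≈Tⱼ v = begin
    T i ⊙ W ⊛ v                     ≡⟨ cong (_⊙ W ⊛ v) Tᵢ≡hx ⟩
    (h · x) ⊙ W ⊛ v                 ≡⟨ ·-⊙ h x (W ⊛ v) ⟩
    h ⊙ x ⊙ W ⊛ v                   ≡⟨ cong (h ⊙_) (x≈u (W ⊛ v)) ⟩
    h ⊙ u ⊛ (inverse u ++ w) ⊛ v    ≡⟨ cong (λ z → h ⊙ u ⊛ z) (⊛-++ (inverse u) w v) ⟩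
    h ⊙ u ⊛ inverse u ⊛ w ⊛ v       ≡⟨ cong (h ⊙_) (inverse-⊛ʳ u (w ⊛ v)) ⟩
    h ⊙ w ⊛ v                       ≡⟨ cong (h ⊙_) (y≈w v) ⟨
    h ⊙ y ⊙ v                       ≡⟨ ·-⊙ h y v ⟨
    (h · y) ⊙ v                     ≡⟨ cong (_⊙ v) Tⱼ≡hy ⟨
    T j ⊙ v                         ∎
  W-fixes-q : W ⊛ q ≡ q
  W-fixes-q = begin
    W ⊛ q                 ≡⟨ T-inverse-⊙ i (W ⊛ q) ⟨
    T (- i) ⊙ T i ⊙ W ⊛ q ≡⟨ cong (T (- i) ⊙_) (trans (Tᵢ∘W≈Tⱼ q) (T-fixes-q j)) ⟩
    T (- i) ⊙ q           ≡⟨ T-fixes-q (- i) ⟩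
    q                     ∎
  Tᵢ≈Tⱼ : ∀ v → T i ⊙ v ≡ T j ⊙ v
  Tᵢ≈Tⱼ v = trans (cong (T i ⊙_) (sym (q-stabiliser-trivial W W-fixes-q v))) (Tᵢ∘W≈Tⱼ v)

pigeonhole-∈ : ∀ {X : Set} {P : ℕ → X → Set} (L : List X) → (∀ k → Σ X λ a → a ∈ L × P k a) →
               Σ ℕ λ i → Σ ℕ λ j → i ℕ.< j × Σ X λ a → P i a × P j a
pigeonhole-∈ {X} {P} L witness =
  let i , j , i<j , same-index = Fin.pigeonhole (ℕₚ.n<1+n (length L)) (index ∘ member ∘ toℕ)
  in toℕ i , toℕ j , i<j , point (toℕ i) , property (toℕ i) ,
     subst (P (toℕ j)) (same-point (sym same-index)) (property (toℕ j))
  where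
  point : ℕ → X
  point k = proj₁ (witness k)
  member : ∀ k → point k ∈ L
  member k = proj₁ (proj₂ (witness k))
  property : ∀ k → P k (point k)
  property k = proj₂ (proj₂ (witness k))
  same-point : ∀ {k l} → index (member k) ≡ index (member l) → point k ≡ point l
  same-point {k} {l} same = trans (lookup-index (member k))
                                  (trans (cong (List.lookup L) same) (sym (lookup-index (member l))))

T-in-coset : ℕ → Mat → Set
T-in-coset k h = Σ Mat λ x → InΓ x × T (+ k) ≡ h · x

theoremA1 : ¬ FiniteIndexInSp4
theoremA1 (L , _ , cover) =
  let i , j , i<j , h , (x , x∈Γ , Tᵢ≡hx) , (y , y∈Γ , Tⱼ≡hy) =
        pigeonhole-∈ {P = T-in-coset} L (λ k → cover (T (+ k)) (T-symplectic (+ k)))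
  in ℕₚ.<-irrefl (+-injective (T-cosets-distinct {h} {x} {y} (+ i) (+ j) x∈Γ y∈Γ Tᵢ≡hx Tⱼ≡hy)) i<j
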